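{- Let $G$ be a closed subgroup of $\mathrm{Sym}(D)$ containing $\mathrm{Aut}(D,E)$, and let $f\in\overline{\mathrm{tmcl}}(G)$ be a canonical function from $(D,E,<)$ to $(D,E)$. Then at least one of the following holds: $f$ behaves like the identity; $f$ behaves like $-$ (i.e. $E(f(x),f(y))\iff E(y,x)$ for all $x,y$ and $f$ is injective); $G\supseteq\mathrm{Aut}(\Gamma)$.
   Context: $(D,E)$ is the generic digraph: the unique up to isomorphism countable homogeneous digraph (irreflexive antisymmetric edge relation $E$) into which every finite digraph embeds. $\Gamma=(D,E_\Gamma)$ with $E_\Gamma(x,y)\iff E(x,y)\vee E(y,x)$. $D^D$ carries the product topology ($D$ discrete) and $\mathrm{Sym}(D)$ the subspace topology; $\overline{\mathrm{tmcl}}(G)$ denotes the smallest closed submonoid of $D^D$ containing $G\cup\mathrm{Aut}(D,E)$. Fix a linear order $<$ on $D$ such that $(D,E,<)$ is the countable homogeneous ordered digraph embedding all finite linearly ordered digraphs. A function $f:D\to D$ is canonical from $(D,E,<)$ to $(D,E)$ if whenever two finite tuples $\bar a,\bar a'$ are isomorphic in $(D,E,<)$ (i.e. $a_i\mapsto a'_i$ is a well-defined isomorphism of induced ordered digraphs), the tuples $f(\bar a),f(\bar a')$ are isomorphic as digraphs. $f$ behaves like the identity if $f(\bar a)\cong\bar a$ as digraphs for every finite tuple $\bar a$. -}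

module Defs where

open import Data.Nat using (ℕ)
open import Data.Fin using (Fin)
open import Data.Bool using (Bool; true; false; _∨_)
open import Data.Product using (Σ; _×_; ∃; _,_)
open import Data.Sum using (_⊎_)
open import Function using (_∘_; id; _⇔_)
open import Relation.Binary.PropositionalEquality using (_≡_; _≢_)
open import Level using (Level; suc; zero)

-- Carrier of the (countable) structures: D = ℕ.
-- Relations are Bool-valued: E x y ≡ true means (x,y) is an edge.
BRel : Set
BRel = ℕ → ℕ → Bool

Tuple : ℕ → Set
Tuple n = Fin n → ℕ

IsDigraph : {A : Set} → (A → A → Bool) → Set
IsDigraph {A} R = (∀ x → R x x ≡ false) × (∀ x y → R x y ≡ true → R y x ≡ false)

IsStrictLinearOrder : {A : Set} → (A → A → Bool) → Set
IsStrictLinearOrder {A} L =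
  (∀ x → L x x ≡ false) ×
  (∀ x y z → L x y ≡ true → L y z ≡ true → L x z ≡ true) ×
  (∀ x y → x ≢ y → (L x y ≡ true) ⊎ (L y x ≡ true))

-- symmetrisation Γ of a digraph
Sym : BRel → BRel
Sym E x y = E x y ∨ E y x

IsoTup : BRel → {n : ℕ} → Tuple n → Tuple n → Set
IsoTup E a b = ∀ i j → ((a i ≡ a j) ⇔ (b i ≡ b j)) × (E (a i) (a j) ≡ E (b i) (b j))

IsoTupOrd : BRel → BRel → {n : ℕ} → Tuple n → Tuple n → Set
IsoTupOrd E L a b = IsoTup E a b × (∀ i j → L (a i) (a j) ≡ L (b i) (b j))

IsPerm : (ℕ → ℕ) → Set
IsPerm f = Σ (ℕ → ℕ) λ g → (∀ x → g (f x) ≡ x) × (∀ y → f (g y) ≡ y)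

IsAut : BRel → (ℕ → ℕ) → Set
IsAut E f = IsPerm f × (∀ x y → E (f x) (f y) ≡ E x y)

IsAutOrd : BRel → BRel → (ℕ → ℕ) → Set
IsAutOrd E L f = IsAut E f × (∀ x y → L (f x) (f y) ≡ L x y)

Injective : (ℕ → ℕ) → Set
Injective f = ∀ x y → f x ≡ f y → x ≡ y

IsHomogeneous : BRel → Set
IsHomogeneous E = ∀ n (a b : Tuple n) → IsoTup E a b →
  Σ (ℕ → ℕ) λ α → IsAut E α × (∀ i → α (a i) ≡ b i)

IsHomogeneousOrd : BRel → BRel → Set
IsHomogeneousOrd E L = ∀ n (a b : Tuple n) → IsoTupOrd E L a b →
  Σ (ℕ → ℕ) λ α → IsAutOrd E L α × (∀ i → α (a i) ≡ b i)

IsUniversal : BRel → Set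
IsUniversal E = ∀ n (R : Fin n → Fin n → Bool) → IsDigraph R →
  Σ (Tuple n) λ h → (∀ i j → h i ≡ h j → i ≡ j) × (∀ i j → E (h i) (h j) ≡ R i j)

IsUniversalOrd : BRel → BRel → Set
IsUniversalOrd E L = ∀ n (R O : Fin n → Fin n → Bool) → IsDigraph R → IsStrictLinearOrder O →
  Σ (Tuple n) λ h → (∀ i j → h i ≡ h j → i ≡ j) ×
     (∀ i j → E (h i) (h j) ≡ R i j) × (∀ i j → L (h i) (h j) ≡ O i j)

IsGenericDigraph : BRel → Set
IsGenericDigraph E = IsDigraph E × IsHomogeneous E × IsUniversal E

IsGenericOrderedDigraph : BRel → BRel → Set
IsGenericOrderedDigraph E L =
  IsDigraph E × IsStrictLinearOrder L × IsHomogeneousOrd E L × IsUniversalOrd E L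

InClosure : ((ℕ → ℕ) → Set) → (ℕ → ℕ) → Set
InClosure M f = ∀ n (a : Tuple n) → Σ (ℕ → ℕ) λ g → M g × (∀ i → g (a i) ≡ f (a i))

IsClosedSubgroup : ((ℕ → ℕ) → Set) → Set
IsClosedSubgroup G =
  (∀ g → G g → IsPerm g) ×
  G id ×
  (∀ g h → G g → G h → G (g ∘ h)) ×
  (∀ g → G g → Σ (ℕ → ℕ) λ h → G h × (∀ x → h (g x) ≡ x) × (∀ y → g (h y) ≡ y)) ×
  (∀ p → IsPerm p → InClosure G p → G p)

IsClosedSubmonoid : ((ℕ → ℕ) → Set) → Set
IsClosedSubmonoid M =
  M id × (∀ g h → M g → M h → M (g ∘ h)) × (∀ f → InClosure M f → M f)

-- f ∈ \overline{tmcl}(G): f lies in every closed submonoid of D^D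
-- containing G ∪ Aut(D,E)
InTmcl : BRel → ((ℕ → ℕ) → Set) → (ℕ → ℕ) → Set₁
InTmcl E G f = ∀ (M : (ℕ → ℕ) → Set) → IsClosedSubmonoid M →
  (∀ g → G g → M g) → (∀ g → IsAut E g → M g) → M f

IsCanonical : BRel → BRel → (ℕ → ℕ) → Set
IsCanonical E L f = ∀ n (a a' : Tuple n) → IsoTupOrd E L a a' → IsoTup E (f ∘ a) (f ∘ a')

BehavesLikeId : BRel → (ℕ → ℕ) → Set
BehavesLikeId E f = ∀ n (a : Tuple n) → IsoTup E (f ∘ a) a

BehavesLikeMinus : BRel → (ℕ → ℕ) → Set
BehavesLikeMinus E f = Injective f × (∀ x y → E (f x) (f y) ≡ E y x)

module Submission where

-- The maps moving every
-- finite tuple within its G-orbit form a closed monoid containing G ∪ Aut(D,E),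
-- so f is such a map (tmcl-orbit); in particular f is injective.  By
-- canonicity, for x < y the type of (f x, f y) (forward edge, backward edge or
-- non-edge) is F (type of (x,y)) for a fixed map F on pair types.  Either F is
-- the identity (f behaves like id), or F reverses edges (f behaves like −), or
-- F is degenerate (trichotomy).  In the degenerate case, choosing where two
-- vertices i, j sit in the order (as the two least elements, in either
-- orientation) shows that reversing the edge between i and j in a finite
-- digraph keeps its realisations in one G-orbit (reversalLinked).  Repeating
-- this pair by pair, finite induced subgraphs with the same underlying graph
-- lie in one G-orbit, and G ⊇ Aut(Γ) as G is closed.

open import Defs
open import Data.Bool using (Bool; true; false; _∨_)
import Data.Bool as Bool
open import Data.Bool.Properties using (T-≡)
open import Data.Empty using (⊥-elim)
open import Data.Fin using (Fin; zero; suc; toℕ; fromℕ<; _≟_)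
open import Data.Fin.Properties using (toℕ-injective; toℕ-fromℕ<)
open import Data.List using (List; []; _∷_; cartesianProduct; allFin)
open import Data.List.Membership.Propositional using (_∈_)
open import Data.List.Membership.Propositional.Properties using (∈-cartesianProduct⁺; ∈-allFin)
open import Data.List.Relation.Unary.Any using (here; there)
open import Data.Nat using (ℕ; _+_; _<_; _≤_; _⊔_; s≤s; _<?_)
import Data.Nat as ℕ
open import Data.Nat.Properties
  using (<ᵇ⇒<; <-irrefl; <-trans; <-cmp; ≤-trans; m≤m⊔n; m≤n⊔m; suc-injective; 0≢1+n; 1+n≢0)
open import Data.Product using (Σ; _×_; _,_; proj₁; proj₂)
open import Data.Sum using (_⊎_; inj₁; inj₂)
open import Function using (_∘_; id; mk⇔)
open import Function.Bundles using (module Equivalence)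
open import Relation.Binary using (tri<; tri≈; tri>)
open import Relation.Binary.PropositionalEquality
open import Relation.Nullary using (¬_; Dec; yes; no; does; _×-dec_; _⊎-dec_)
open import Relation.Nullary.Decidable using (dec-true; dec-false)

true≢false : true ≢ false
true≢false ()

FinRel : ℕ → Set
FinRel n = Fin n → Fin n → Bool

data PairType : Set where
  fwd bwd non : PairType

bitsType : Bool → Bool → PairType
bitsType true  _     = fwd
bitsType false true  = bwd
bitsType false false = non

pairType : {A : Set} → (A → A → Bool) → A → A → PairType
pairType R x y = bitsType (R x y) (R y x)

reverse : PairType → PairType
reverse fwd = bwd
reverse bwd = fwd
reverse non = non

reverse-involutive : ∀ t → reverse (reverse t) ≡ t
reverse-involutive fwd = refl
reverse-involutive bwd = refl
reverse-involutive non = refl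

isFwd : PairType → Bool
isFwd fwd = true
isFwd bwd = false
isFwd non = false

isFwd-pairType : {A : Set} (R : A → A → Bool) (x y : A) → isFwd (pairType R x y) ≡ R x y
isFwd-pairType R x y with R x y | R y x
... | true  | _     = refl
... | false | true  = refl
... | false | false = refl

edge-from-pairType : {A B : Set} {R : A → A → Bool} {S : B → B → Bool} {x y : A} {a b : B} →
  pairType R x y ≡ pairType S a b → R x y ≡ S a b
edge-from-pairType {R = R} {S} {x} {y} {a} {b} e =
  trans (sym (isFwd-pairType R x y)) (trans (cong isFwd e) (isFwd-pairType S a b))

pairType-swap : {A : Set} {R : A → A → Bool} → IsDigraph R →
  ∀ x y → pairType R y x ≡ reverse (pairType R x y)
pairType-swap {R = R} (_ , asym) x y with R x y in exy | R y x in eyx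
... | true  | true  = ⊥-elim (true≢false (trans (sym eyx) (asym x y exy)))
... | true  | false = refl
... | false | true  = refl
... | false | false = refl

pairType-edge : {A : Set} {R : A → A → Bool} → IsDigraph R → ∀ {x y} → R x y ≡ true →
  pairType R x y ≡ fwd × pairType R y x ≡ bwd
pairType-edge {R = R} dR {x} {y} e with R x y | pairType-swap dR x y
... | true | swap = refl , swap

Degenerate : (PairType → PairType) → Set
Degenerate F = F fwd ≡ F bwd ⊎ F fwd ≡ non ⊎ F bwd ≡ non ⊎ F non ≡ F fwd ⊎ F non ≡ F bwd

trichotomy : (F : PairType → PairType) →
  (∀ t → F t ≡ t) ⊎ (∀ t → F t ≡ reverse t) ⊎ Degenerate F
trichotomy F = go (F fwd) (F bwd) (F non) refl refl refl
  where
  go : ∀ a b c → F fwd ≡ a → F bwd ≡ b → F non ≡ c →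
    (∀ t → F t ≡ t) ⊎ (∀ t → F t ≡ reverse t) ⊎ Degenerate F
  go fwd fwd _   p q r = inj₂ (inj₂ (inj₁ (trans p (sym q))))
  go bwd bwd _   p q r = inj₂ (inj₂ (inj₁ (trans p (sym q))))
  go non _   _   p q r = inj₂ (inj₂ (inj₂ (inj₁ p)))
  go _   non _   p q r = inj₂ (inj₂ (inj₂ (inj₂ (inj₁ q))))
  go fwd bwd non p q r = inj₁ λ { fwd → p ; bwd → q ; non → r }
  go fwd bwd fwd p q r = inj₂ (inj₂ (inj₂ (inj₂ (inj₂ (inj₁ (trans r (sym p)))))))
  go fwd bwd bwd p q r = inj₂ (inj₂ (inj₂ (inj₂ (inj₂ (inj₂ (trans r (sym q)))))))
  go bwd fwd non p q r = inj₂ (inj₁ λ { fwd → p ; bwd → q ; non → r })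
  go bwd fwd bwd p q r = inj₂ (inj₂ (inj₂ (inj₂ (inj₂ (inj₁ (trans r (sym p)))))))
  go bwd fwd fwd p q r = inj₂ (inj₂ (inj₂ (inj₂ (inj₂ (inj₂ (trans r (sym q)))))))

linear-asym : {A : Set} {O : A → A → Bool} → IsStrictLinearOrder O →
  ∀ x y → O x y ≡ true → O y x ≡ false
linear-asym {O = O} (irr , tr , _) x y p with O y x in q
... | false = refl
... | true  = ⊥-elim (true≢false (trans (sym (tr x y x p q)) (irr x)))

linear-flip : {A : Set} {O : A → A → Bool} → IsStrictLinearOrder O →
  ∀ x y → x ≢ y → O x y ≡ false → O y x ≡ true
linear-flip (_ , _ , total) x y x≢y p with total x y x≢y
... | inj₁ q = ⊥-elim (true≢false (trans (sym q) p))
... | inj₂ q = q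

keyOrder : ∀ {n} → (Fin n → ℕ) → FinRel n
keyOrder κ k l = does (κ k <? κ l)

keyOrder-sound : ∀ {n} (κ : Fin n → ℕ) k l → keyOrder κ k l ≡ true → κ k < κ l
keyOrder-sound κ k l e = <ᵇ⇒< (κ k) (κ l) (Equivalence.from T-≡ e)

keyOrder-linear : ∀ {n} (κ : Fin n → ℕ) → (∀ k l → κ k ≡ κ l → k ≡ l) →
  IsStrictLinearOrder (keyOrder κ)
keyOrder-linear κ κ-injective = irreflexive , transitive , total
  where
  irreflexive : ∀ k → keyOrder κ k k ≡ false
  irreflexive k = dec-false (κ k <? κ k) (<-irrefl refl)
  transitive : ∀ k l m → keyOrder κ k l ≡ true → keyOrder κ l m ≡ true → keyOrder κ k m ≡ true
  transitive k l m p q = dec-true (κ k <? κ m) (<-trans (keyOrder-sound κ k l p) (keyOrder-sound κ l m q))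
  total : ∀ k l → k ≢ l → keyOrder κ k l ≡ true ⊎ keyOrder κ l k ≡ true
  total k l k≢l with <-cmp (κ k) (κ l)
  ... | tri< p _ _ = inj₁ (dec-true (κ k <? κ l) p)
  ... | tri≈ _ p _ = ⊥-elim (k≢l (κ-injective k l p))
  ... | tri> _ _ p = inj₂ (dec-true (κ l <? κ k) p)

OnPair : ∀ {n} → Fin n → Fin n → Fin n → Fin n → Set
OnPair i j k l = (k ≡ i × l ≡ j) ⊎ (k ≡ j × l ≡ i)

onPair? : ∀ {n} (i j k l : Fin n) → Dec (OnPair i j k l)
onPair? i j k l = (k ≟ i ×-dec l ≟ j) ⊎-dec (k ≟ j ×-dec l ≟ i)

OnPair-flip : ∀ {n} {i j k l : Fin n} → OnPair i j k l → OnPair i j l k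
OnPair-flip (inj₁ (p , q)) = inj₂ (q , p)
OnPair-flip (inj₂ (p , q)) = inj₁ (q , p)

OnPair-swap : ∀ {n} {i j k l : Fin n} → OnPair i j k l → OnPair j i k l
OnPair-swap (inj₁ p) = inj₂ p
OnPair-swap (inj₂ p) = inj₁ p

AgreeOff : ∀ {n} → Fin n → Fin n → FinRel n → FinRel n → Set
AgreeOff i j R S = ∀ k l → ¬ OnPair i j k l → R k l ≡ S k l

AgreeOff-swap : ∀ {n} {i j : Fin n} {R S} → AgreeOff i j R S → AgreeOff j i R S
AgreeOff-swap agree k l off = agree k l (off ∘ OnPair-swap)

override : ∀ {n} → Fin n → Fin n → FinRel n → FinRel n → FinRel n
override i j A B k l with onPair? i j k l
... | yes _ = B k l
... | no _  = A k l

override-on : ∀ {n} {i j k l : Fin n} {A B} → OnPair i j k l → override i j A B k l ≡ B k l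
override-on {i = i} {j} {k} {l} p with onPair? i j k l
... | yes _ = refl
... | no ¬p = ⊥-elim (¬p p)

override-off : ∀ {n} {i j k l : Fin n} {A B} → ¬ OnPair i j k l → override i j A B k l ≡ A k l
override-off {i = i} {j} {k} {l} ¬p with onPair? i j k l
... | yes p = ⊥-elim (¬p p)
... | no _  = refl

override-digraph : ∀ {n} (i j : Fin n) {A B} → IsDigraph A → IsDigraph B → IsDigraph (override i j A B)
override-digraph i j {A} {B} (irrA , asymA) (irrB , asymB) = irreflexive , asymmetric
  where
  irreflexive : ∀ k → override i j A B k k ≡ false
  irreflexive k with onPair? i j k k
  ... | yes _ = irrB k
  ... | no _  = irrA k
  asymmetric : ∀ k l → override i j A B k l ≡ true → override i j A B l k ≡ false
  asymmetric k l e with onPair? i j k l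
  ... | yes p = trans (override-on (OnPair-flip p)) (asymB k l e)
  ... | no ¬p = trans (override-off (¬p ∘ OnPair-flip)) (asymA k l e)

empty-digraph : ∀ {n} → IsDigraph {Fin n} (λ _ _ → false)
empty-digraph = (λ _ → refl) , (λ _ _ ())

edge-distinct : ∀ {n} {R : FinRel n} {k l} → IsDigraph R → R k l ≡ true → k ≢ l
edge-distinct dR rkl refl = true≢false (trans (sym rkl) (proj₁ dR _))

SameGraph : ∀ {n} → FinRel n → FinRel n → Set
SameGraph R B = ∀ k l → (R k l ∨ R l k) ≡ (B k l ∨ B l k)

pairKey : ∀ {n} → Fin n → Fin n → Fin n → ℕ
pairKey i j k with k ≟ i | k ≟ j
... | yes _ | _     = 0
... | no _  | yes _ = 1
... | no _  | no _  = 2 + toℕ k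

pairKey-first : ∀ {n} (i j : Fin n) → pairKey i j i ≡ 0
pairKey-first i j with i ≟ i
... | yes _ = refl
... | no i≢i = ⊥-elim (i≢i refl)

pairKey-second : ∀ {n} {i j : Fin n} → i ≢ j → pairKey i j j ≡ 1
pairKey-second {i = i} {j} i≢j with j ≟ i | j ≟ j
... | yes j≡i | _     = ⊥-elim (i≢j (sym j≡i))
... | no _    | yes _ = refl
... | no _    | no j≢j = ⊥-elim (j≢j refl)

pairKey-other : ∀ {n} {i j k : Fin n} → k ≢ i → k ≢ j → pairKey i j k ≡ 2 + toℕ k
pairKey-other {i = i} {j} {k} k≢i k≢j with k ≟ i | k ≟ j
... | yes k≡i | _     = ⊥-elim (k≢i k≡i)
... | no _    | yes k≡j = ⊥-elim (k≢j k≡j)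
... | no _    | no _  = refl

data Position {n} (i j : Fin n) : Fin n → Set where
  first  : Position i j i
  second : Position i j j
  other  : ∀ {k} → k ≢ i → k ≢ j → Position i j k

position : ∀ {n} (i j k : Fin n) → Position i j k
position i j k with k ≟ i | k ≟ j
... | yes refl | _        = first
... | no _     | yes refl = second
... | no k≢i   | no k≢j   = other k≢i k≢j

≡-via : {A : Set} {x y a b : A} → x ≡ y → x ≡ a → y ≡ b → a ≡ b
≡-via e p q = trans (sym p) (trans e q)

pairKey-injective : ∀ {n} {i j : Fin n} → i ≢ j → ∀ k l → pairKey i j k ≡ pairKey i j l → k ≡ l
pairKey-injective {i = i} {j} i≢j k l e with position i j k | position i j l
... | first  | first  = refl
... | second | second = refl
... | first  | second = ⊥-elim (0≢1+n (≡-via e (pairKey-first i j) (pairKey-second i≢j)))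
... | second | first  = ⊥-elim (1+n≢0 (≡-via e (pairKey-second i≢j) (pairKey-first i j)))
... | first  | other l≢i l≢j = ⊥-elim (0≢1+n (≡-via e (pairKey-first i j) (pairKey-other l≢i l≢j)))
... | second | other l≢i l≢j =
  ⊥-elim (0≢1+n (suc-injective (≡-via e (pairKey-second i≢j) (pairKey-other l≢i l≢j))))
... | other k≢i k≢j | first  = ⊥-elim (1+n≢0 (≡-via e (pairKey-other k≢i k≢j) (pairKey-first i j)))
... | other k≢i k≢j | second =
  ⊥-elim (1+n≢0 (suc-injective (≡-via e (pairKey-other k≢i k≢j) (pairKey-second i≢j))))
... | other k≢i k≢j | other l≢i l≢j =
  toℕ-injective (suc-injective (suc-injective (≡-via e (pairKey-other k≢i k≢j) (pairKey-other l≢i l≢j))))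

pairOrder : ∀ {n} → Fin n → Fin n → FinRel n
pairOrder i j = keyOrder (pairKey i j)

pairOrder-linear : ∀ {n} {i j : Fin n} → i ≢ j → IsStrictLinearOrder (pairOrder i j)
pairOrder-linear i≢j = keyOrder-linear _ (pairKey-injective i≢j)

pairOrder-below : ∀ {n} {i j : Fin n} → i ≢ j → pairOrder i j i j ≡ true
pairOrder-below {i = i} {j} i≢j rewrite pairKey-first i j | pairKey-second i≢j = refl

pairOrder-via : ∀ {n} (i j k l : Fin n) {a b a' b' : ℕ} →
  pairKey i j k ≡ a → pairKey i j l ≡ b → pairKey j i k ≡ a' → pairKey j i l ≡ b' →
  does (a <? b) ≡ does (a' <? b') → pairOrder i j k l ≡ pairOrder j i k l
pairOrder-via i j k l p q p' q' e =
  trans (cong₂ compare p q) (trans e (sym (cong₂ compare p' q')))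
  where
  compare : ℕ → ℕ → Bool
  compare a b = does (a <? b)

pairOrder-agree : ∀ {n} {i j : Fin n} → i ≢ j → AgreeOff i j (pairOrder i j) (pairOrder j i)
pairOrder-agree {i = i} {j} i≢j k l off with position i j k | position i j l
... | first  | first  = pairOrder-via i j i i (pairKey-first i j) (pairKey-first i j)
  (pairKey-second (i≢j ∘ sym)) (pairKey-second (i≢j ∘ sym)) refl
... | second | second = pairOrder-via i j j j (pairKey-second i≢j) (pairKey-second i≢j)
  (pairKey-first j i) (pairKey-first j i) refl
... | first  | second = ⊥-elim (off (inj₁ (refl , refl)))
... | second | first  = ⊥-elim (off (inj₂ (refl , refl)))
... | first  | other l≢i l≢j = pairOrder-via i j i l (pairKey-first i j) (pairKey-other l≢i l≢j)
  (pairKey-second (i≢j ∘ sym)) (pairKey-other l≢j l≢i) refl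
... | second | other l≢i l≢j = pairOrder-via i j j l (pairKey-second i≢j) (pairKey-other l≢i l≢j)
  (pairKey-first j i) (pairKey-other l≢j l≢i) refl
... | other k≢i k≢j | first = pairOrder-via i j k i (pairKey-other k≢i k≢j) (pairKey-first i j)
  (pairKey-other k≢j k≢i) (pairKey-second (i≢j ∘ sym)) refl
... | other k≢i k≢j | second = pairOrder-via i j k j (pairKey-other k≢i k≢j) (pairKey-second i≢j)
  (pairKey-other k≢j k≢i) (pairKey-first j i) refl
... | other k≢i k≢j | other l≢i l≢j =
  pairOrder-via i j k l (pairKey-other k≢i k≢j) (pairKey-other l≢i l≢j)
  (pairKey-other k≢j k≢i) (pairKey-other l≢j l≢i) refl

sameUnderlying : ∀ {a b c d : Bool} → (a ≡ true → b ≡ false) → (c ≡ true → d ≡ false) →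
  (a ∨ b) ≡ (c ∨ d) → (a ≡ c × b ≡ d) ⊎ (a ≡ true × d ≡ true) ⊎ (b ≡ true × c ≡ true)
sameUnderlying {true}  {true}  asym₁ _ _ = ⊥-elim (true≢false (asym₁ refl))
sameUnderlying {c = true} {true} _ asym₂ _ = ⊥-elim (true≢false (asym₂ refl))
sameUnderlying {true}  {false} {true}  {false} _ _ _ = inj₁ (refl , refl)
sameUnderlying {true}  {false} {false} {true}  _ _ _ = inj₂ (inj₁ (refl , refl))
sameUnderlying {false} {true}  {true}  {false} _ _ _ = inj₂ (inj₂ (refl , refl))
sameUnderlying {false} {true}  {false} {true}  _ _ _ = inj₁ (refl , refl)
sameUnderlying {false} {false} {false} {false} _ _ _ = inj₁ (refl , refl)
sameUnderlying {true}  {false} {false} {false} _ _ ()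
sameUnderlying {false} {true}  {false} {false} _ _ ()
sameUnderlying {false} {false} {true}  {false} _ _ ()
sameUnderlying {false} {false} {false} {true}  _ _ ()

tupleMax : ∀ n → Tuple n → ℕ
tupleMax ℕ.zero    a = 0
tupleMax (ℕ.suc n) a = a zero ⊔ tupleMax n (a ∘ suc)

tupleMax-bound : ∀ n (a : Tuple n) i → a i ≤ tupleMax n a
tupleMax-bound (ℕ.suc n) a zero    = m≤m⊔n (a zero) _
tupleMax-bound (ℕ.suc n) a (suc i) = ≤-trans (tupleMax-bound n (a ∘ suc) i) (m≤n⊔m (a zero) _)

agree-below : ∀ {m} (g h : ℕ → ℕ) → (∀ (k : Fin m) → g (toℕ k) ≡ h (toℕ k)) →
  ∀ x → x < m → g x ≡ h x
agree-below g h same x x<m = subst (λ z → g z ≡ h z) (toℕ-fromℕ< x<m) (same (fromℕ< x<m))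

refPair : PairType → FinRel 2
refPair t zero       (suc zero) = isFwd t
refPair t (suc zero) zero       = isFwd (reverse t)
refPair t _          _          = false

refPair-digraph : ∀ t → IsDigraph (refPair t)
refPair-digraph t = irreflexive , asymmetric
  where
  irreflexive : ∀ k → refPair t k k ≡ false
  irreflexive zero       = refl
  irreflexive (suc zero) = refl
  forward : ∀ s → isFwd s ≡ true → isFwd (reverse s) ≡ false
  forward fwd _ = refl
  backward : ∀ s → isFwd (reverse s) ≡ true → isFwd s ≡ false
  backward bwd _ = refl
  asymmetric : ∀ k l → refPair t k l ≡ true → refPair t l k ≡ false
  asymmetric zero       (suc zero) e = forward t e
  asymmetric (suc zero) zero       e = backward t e
  asymmetric zero       zero       ()
  asymmetric (suc zero) (suc zero) ()

order₂ : FinRel 2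
order₂ = keyOrder toℕ

order₂-linear : IsStrictLinearOrder order₂
order₂-linear = keyOrder-linear toℕ (λ _ _ → toℕ-injective)

pair : ℕ → ℕ → Tuple 2
pair x y zero    = x
pair x y (suc _) = y

module Generic (E L : BRel) (E-generic : IsGenericDigraph E) (EL-generic : IsGenericOrderedDigraph E L)
  (G : (ℕ → ℕ) → Set) (G-closed : IsClosedSubgroup G) (Aut⊆G : ∀ g → IsAut E g → G g) where

  E-digraph : IsDigraph E
  E-digraph = proj₁ E-generic

  E-irreflexive : ∀ x → E x x ≡ false
  E-irreflexive = proj₁ E-digraph

  L-linear : IsStrictLinearOrder L
  L-linear = proj₁ (proj₂ EL-generic)

  G-permutations : ∀ g → G g → IsPerm g
  G-permutations = proj₁ G-closed

  permutation-injective : ∀ {h} → IsPerm h → Injective h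
  permutation-injective {h} (h⁻¹ , left , _) x y e = trans (sym (left x)) (trans (cong h⁻¹ e) (left y))

  infix 4 _∼_
  _∼_ : ∀ {n} → Tuple n → Tuple n → Set
  a ∼ b = Σ (ℕ → ℕ) λ h → G h × (∀ k → h (a k) ≡ b k)

  ∼-refl : ∀ {n} {a : Tuple n} → a ∼ a
  ∼-refl = id , proj₁ (proj₂ G-closed) , λ _ → refl

  ∼-sym : ∀ {n} {a b : Tuple n} → a ∼ b → b ∼ a
  ∼-sym {a = a} (h , h∈G , ha≡b) with proj₁ (proj₂ (proj₂ (proj₂ G-closed))) h h∈G
  ... | h⁻¹ , h⁻¹∈G , left , _ =
    h⁻¹ , h⁻¹∈G , λ k → trans (cong h⁻¹ (sym (ha≡b k))) (left (a k))

  ∼-trans : ∀ {n} {a b c : Tuple n} → a ∼ b → b ∼ c → a ∼ c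
  ∼-trans (h , h∈G , ha≡b) (h' , h'∈G , h'b≡c) =
    h' ∘ h , proj₁ (proj₂ (proj₂ G-closed)) h' h h'∈G h∈G , λ k → trans (cong h' (ha≡b k)) (h'b≡c k)

  iso⇒∼ : ∀ {n} {a b : Tuple n} → IsoTup E a b → a ∼ b
  iso⇒∼ {n} {a} {b} iso with proj₁ (proj₂ E-generic) n a b iso
  ... | α , α-aut , αa≡b = α , Aut⊆G α α-aut , αa≡b

  -- Every f ∈ tmcl(G) keeps each finite tuple in its G-orbit: the maps with
  -- this property form a closed monoid containing G ∪ Aut(D,E).
  tmcl-orbit : ∀ {f} → InTmcl E G f → ∀ {n} (a : Tuple n) → a ∼ f ∘ a
  tmcl-orbit f-tmcl {n} a = f-tmcl OrbitPreserving closed-monoid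
    (λ g g∈G _ _ → g , g∈G , λ _ → refl) (λ g g-aut _ _ → g , Aut⊆G g g-aut , λ _ → refl) n a
    where
    OrbitPreserving : (ℕ → ℕ) → Set
    OrbitPreserving g = ∀ n (a : Tuple n) → a ∼ g ∘ a
    closed-monoid : IsClosedSubmonoid OrbitPreserving
    closed-monoid =
      (λ _ _ → ∼-refl) , (λ g h g-pres h-pres n a → ∼-trans (h-pres n a) (g-pres n (h ∘ a))) , closed
      where
      closed : ∀ g → InClosure OrbitPreserving g → OrbitPreserving g
      closed g approx n a with approx n a
      ... | g' , g'-pres , g'a≡ga with g'-pres n a
      ...   | h , h∈G , ha≡g'a = h , h∈G , λ k → trans (ha≡g'a k) (g'a≡ga k)

  -- Elements of tmcl(G) are injective, since their restriction to each pair
  -- agrees with a permutation in G.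
  tmcl-injective : ∀ {f} → InTmcl E G f → Injective f
  tmcl-injective f-tmcl x y fx≡fy with tmcl-orbit f-tmcl (pair x y)
  ... | h , h∈G , h≡f = permutation-injective (G-permutations h h∈G) x y
    (trans (h≡f zero) (trans fx≡fy (sym (h≡f (suc zero)))))

  Realises : ∀ {n} → FinRel n → Tuple n → Set
  Realises R a = (∀ k l → a k ≡ a l → k ≡ l) × (∀ k l → E (a k) (a l) ≡ R k l)

  OrderedRealises : ∀ {n} → FinRel n → FinRel n → Tuple n → Set
  OrderedRealises R O a = Realises R a × (∀ k l → L (a k) (a l) ≡ O k l)

  realise : ∀ {n} {R : FinRel n} → IsDigraph R → Σ (Tuple n) (Realises R)
  realise {n} dR = proj₂ (proj₂ E-generic) n _ dR

  realiseOrdered : ∀ {n} {R O : FinRel n} → IsDigraph R → IsStrictLinearOrder O →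
    Σ (Tuple n) (OrderedRealises R O)
  realiseOrdered {n} {R} {O} dR lO with proj₂ (proj₂ (proj₂ EL-generic)) n R O dR lO
  ... | a , a-injective , a-edges , a-order = a , (a-injective , a-edges) , a-order

  realises-iso : ∀ {n} {R S : FinRel n} {a b} → Realises R a → Realises S b →
    (∀ k l → R k l ≡ S k l) → IsoTup E a b
  realises-iso {a = a} {b} (a-injective , a-edges) (b-injective , b-edges) R≡S k l =
    mk⇔ (λ e → cong b (a-injective k l e)) (λ e → cong a (b-injective k l e)) ,
    trans (a-edges k l) (trans (R≡S k l) (sym (b-edges k l)))

  realises-pairType : ∀ {n} {R : FinRel n} {a} → Realises R a →
    ∀ k l → pairType E (a k) (a l) ≡ pairType R k l
  realises-pairType (_ , a-edges) k l = cong₂ bitsType (a-edges k l) (a-edges l k)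

  pair-realises : ∀ {x y} → x ≢ y → Realises (refPair (pairType E x y)) (pair x y)
  pair-realises {x} {y} x≢y = injective , edges
    where
    injective : ∀ k l → pair x y k ≡ pair x y l → k ≡ l
    injective zero       zero       _ = refl
    injective zero       (suc zero) e = ⊥-elim (x≢y e)
    injective (suc zero) zero       e = ⊥-elim (x≢y (sym e))
    injective (suc zero) (suc zero) _ = refl
    edges : ∀ k l → E (pair x y k) (pair x y l) ≡ refPair (pairType E x y) k l
    edges zero       zero       = E-irreflexive x
    edges zero       (suc zero) = sym (isFwd-pairType E x y)
    edges (suc zero) zero       = trans (sym (isFwd-pairType E y x)) (cong isFwd (pairType-swap E-digraph x y))
    edges (suc zero) (suc zero) = E-irreflexive y

  pair-ordered : ∀ {x y} → L x y ≡ true → ∀ k l → L (pair x y k) (pair x y l) ≡ order₂ k l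
  pair-ordered {x} {y} x<y zero       zero       = proj₁ L-linear x
  pair-ordered {x} {y} x<y zero       (suc zero) = x<y
  pair-ordered {x} {y} x<y (suc zero) zero       = linear-asym L-linear x y x<y
  pair-ordered {x} {y} x<y (suc zero) (suc zero) = proj₁ L-linear y

  induced : ∀ {n} → Tuple n → FinRel n
  induced c k l = E (c k) (c l)

  induced-digraph : ∀ {n} (c : Tuple n) → IsDigraph (induced c)
  induced-digraph c = (λ k → E-irreflexive (c k)) , (λ k l → proj₂ E-digraph (c k) (c l))

  induced-realises : ∀ {n} {c : Tuple n} → (∀ k l → c k ≡ c l → k ≡ l) → Realises (induced c) c
  induced-realises c-distinct = c-distinct , λ _ _ → refl

  Linked : ∀ {n} → FinRel n → FinRel n → Set
  Linked R S = ∀ a b → Realises R a → Realises S b → a ∼ b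

  linked-pointwise : ∀ {n} {R S : FinRel n} → (∀ k l → R k l ≡ S k l) → Linked R S
  linked-pointwise R≡S a b ra rb = iso⇒∼ (realises-iso ra rb R≡S)

  linked-sym : ∀ {n} {R S : FinRel n} → Linked R S → Linked S R
  linked-sym R~S a b ra rb = ∼-sym (R~S b a rb ra)

  linked-trans : ∀ {n} {R S T : FinRel n} → IsDigraph S → Linked R S → Linked S T → Linked R T
  linked-trans dS R~S S~T a c ra rc with realise dS
  ... | b , rb = ∼-trans (R~S a b ra rb) (S~T b c rb rc)

  module Canonical (f : ℕ → ℕ) (f-tmcl : InTmcl E G f) (f-canonical : IsCanonical E L f) where

    f-injective : ∀ {x y} → f x ≡ f y → x ≡ y
    f-injective = tmcl-injective f-tmcl _ _

    reference : (t : PairType) → Σ (Tuple 2) (OrderedRealises (refPair t) order₂)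
    reference t = realiseOrdered (refPair-digraph t) order₂-linear

    -- F t: the type of the image of any increasing pair of type t.
    F : PairType → PairType
    F t = pairType E (f (r zero)) (f (r (suc zero)))
      where
      r : Tuple 2
      r = proj₁ (reference t)

    pair-behaviour : ∀ {x y} → L x y ≡ true → pairType E (f x) (f y) ≡ F (pairType E x y)
    pair-behaviour {x} {y} x<y = cong₂ bitsType (proj₂ (images zero (suc zero))) (proj₂ (images (suc zero) zero))
      where
      x≢y : x ≢ y
      x≢y refl = true≢false (trans (sym x<y) (proj₁ L-linear x))
      r : Σ (Tuple 2) (OrderedRealises (refPair (pairType E x y)) order₂)
      r = reference (pairType E x y)
      images : IsoTup E (f ∘ pair x y) (f ∘ proj₁ r)
      images = f-canonical 2 (pair x y) (proj₁ r)
        ( realises-iso (pair-realises x≢y) (proj₁ (proj₂ r)) (λ _ _ → refl)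
        , λ k l → trans (pair-ordered x<y k l) (sym (proj₂ (proj₂ r) k l)))

    -- The type predicted for the image of (k,l), given the order O.
    orient : Bool → PairType → PairType → PairType
    orient true  t _  = F t
    orient false _ t' = reverse (F t')

    imageType : {A : Set} → (A → A → Bool) → (A → A → Bool) → A → A → PairType
    imageType R O k l = orient (O k l) (pairType R k l) (pairType R l k)

    imageType-below : ∀ {n} (R O : FinRel n) {k l} → O k l ≡ true → imageType R O k l ≡ F (pairType R k l)
    imageType-below _ _ k<l = cong (λ o → orient o _ _) k<l

    imageType-above : ∀ {n} (R O : FinRel n) {k l} → O k l ≡ false →
      imageType R O k l ≡ reverse (F (pairType R l k))
    imageType-above _ _ k≮l = cong (λ o → orient o _ _) k≮l

    image-lemma : ∀ {x y} → x ≢ y → pairType E (f x) (f y) ≡ imageType E L x y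
    image-lemma {x} {y} x≢y with L x y in x<y
    ... | true  = pair-behaviour x<y
    ... | false = trans (pairType-swap E-digraph (f y) (f x))
                    (cong reverse (pair-behaviour (linear-flip L-linear x y x≢y x<y)))

    image-realised : ∀ {n} {R O : FinRel n} {c} → OrderedRealises R O c → ∀ k l →
      imageType E L (c k) (c l) ≡ imageType R O k l
    image-realised {O = O} (rc , c-order) k l =
      trans (cong (λ o → orient o _ _) (c-order k l))
            (cong₂ (orient (O k l)) (realises-pairType rc k l) (realises-pairType rc l k))

    imageType-reverse : ∀ {n} (R : FinRel n) {O : FinRel n} → IsStrictLinearOrder O → ∀ {i j} → i ≢ j →
      imageType R O j i ≡ reverse (imageType R O i j)
    imageType-reverse R {O} lO {i} {j} i≢j with O i j in oij | O j i in oji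
    ... | true  | true  = ⊥-elim (true≢false (trans (sym oji) (linear-asym lO i j oij)))
    ... | true  | false = refl
    ... | false | true  = sym (reverse-involutive _)
    ... | false | false = ⊥-elim (true≢false (trans (sym (linear-flip lO i j i≢j oij)) oji))

    -- Ordered digraphs with the same predicted image types are linked: with
    -- ordered realisations c, c', we have a ∼ c ∼ f∘c ∼ f∘c' ∼ c' ∼ b, the
    -- middle step because f∘c and f∘c' are isomorphic.
    imageLinked : ∀ {n} {R R' O O' : FinRel n} → IsDigraph R → IsDigraph R' →
      IsStrictLinearOrder O → IsStrictLinearOrder O' →
      (∀ k l → k ≢ l → imageType R O k l ≡ imageType R' O' k l) → Linked R R'
    imageLinked {n} {R} {R'} {O} {O'} dR dR' lO lO' same a b ra rb =
      ∼-trans (iso⇒∼ (realises-iso ra rc (λ _ _ → refl)))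
      (∼-trans (tmcl-orbit f-tmcl c)
      (∼-trans (iso⇒∼ images)
      (∼-trans (∼-sym (tmcl-orbit f-tmcl c')) (iso⇒∼ (realises-iso rc' rb (λ _ _ → refl))))))
      where
      oc : Σ (Tuple n) (OrderedRealises R O)
      oc = realiseOrdered dR lO
      oc' : Σ (Tuple n) (OrderedRealises R' O')
      oc' = realiseOrdered dR' lO'
      c c' : Tuple n
      c  = proj₁ oc
      c' = proj₁ oc'
      rc : Realises R c
      rc = proj₁ (proj₂ oc)
      rc' : Realises R' c'
      rc' = proj₁ (proj₂ oc')
      edges : ∀ k l → E (f (c k)) (f (c l)) ≡ E (f (c' k)) (f (c' l))
      edges k l with k ≟ l
      ... | yes refl = trans (E-irreflexive _) (sym (E-irreflexive _))
      ... | no k≢l = edge-from-pairType {R = E} {S = E} (begin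
        pairType E (f (c k)) (f (c l))    ≡⟨ image-lemma (k≢l ∘ proj₁ rc k l) ⟩
        imageType E L (c k) (c l)         ≡⟨ image-realised (proj₂ oc) k l ⟩
        imageType R O k l                 ≡⟨ same k l k≢l ⟩
        imageType R' O' k l               ≡⟨ image-realised (proj₂ oc') k l ⟨
        imageType E L (c' k) (c' l)       ≡⟨ image-lemma (k≢l ∘ proj₁ rc' k l) ⟨
        pairType E (f (c' k)) (f (c' l))  ∎)
        where open ≡-Reasoning
      images : IsoTup E (f ∘ c) (f ∘ c')
      images k l = mk⇔ (λ e → cong (f ∘ c') (proj₁ rc k l (f-injective e)))
                       (λ e → cong (f ∘ c) (proj₁ rc' k l (f-injective e))) , edges k l

    pairLinked : ∀ {n} {R R' O O' : FinRel n} {i j : Fin n} → i ≢ j → IsDigraph R → IsDigraph R' →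
      IsStrictLinearOrder O → IsStrictLinearOrder O' → AgreeOff i j R R' → AgreeOff i j O O' →
      imageType R O i j ≡ imageType R' O' i j → Linked R R'
    pairLinked {R = R} {R'} {O} {O'} {i} {j} i≢j dR dR' lO lO' R≈R' O≈O' on-pair = imageLinked dR dR' lO lO' same
      where
      same : ∀ k l → k ≢ l → imageType R O k l ≡ imageType R' O' k l
      same k l _ with onPair? i j k l
      ... | yes (inj₁ (refl , refl)) = on-pair
      ... | yes (inj₂ (refl , refl)) =
        trans (imageType-reverse R lO i≢j) (trans (cong reverse on-pair) (sym (imageType-reverse R' lO' i≢j)))
      ... | no off = trans (cong (λ o → orient o _ _) (O≈O' k l off))
        (cong₂ (orient (O' k l)) (cong₂ bitsType Rkl Rlk) (cong₂ bitsType Rlk Rkl))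
        where
        Rkl : R k l ≡ R' k l
        Rkl = R≈R' k l off
        Rlk : R l k ≡ R' l k
        Rlk = R≈R' l k (off ∘ OnPair-flip)

    clearLinked : ∀ {n} {R R₀ : FinRel n} {k l : Fin n} → k ≢ l → IsDigraph R → IsDigraph R₀ →
      AgreeOff k l R R₀ → R₀ k l ≡ false → R₀ l k ≡ false →
      F (pairType R k l) ≡ F non → Linked R R₀
    clearLinked {R = R} {R₀} {k} {l} k≢l dR dR₀ R≈R₀ r₀kl r₀lk same =
      pairLinked k≢l dR dR₀ (pairOrder-linear k≢l) (pairOrder-linear k≢l) R≈R₀ (λ _ _ _ → refl) (begin
        imageType R (pairOrder k l) k l   ≡⟨ imageType-below R (pairOrder k l) (pairOrder-below k≢l) ⟩
        F (pairType R k l)                ≡⟨ same ⟩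
        F non                             ≡⟨ cong F (cong₂ bitsType r₀kl r₀lk) ⟨
        F (pairType R₀ k l)               ≡⟨ imageType-below R₀ (pairOrder k l) (pairOrder-below k≢l) ⟨
        imageType R₀ (pairOrder k l) k l  ∎)
      where open ≡-Reasoning

    -- If F identifies the two edge types or sends one of them to non, then
    -- reversing the edge i → j keeps realisations in one orbit: make i, j the
    -- two least elements of the order, in the same or in opposite orientations.
    reversal-by-order : F fwd ≡ F bwd ⊎ F fwd ≡ non ⊎ F bwd ≡ non → ∀ {n} {R R' : FinRel n} {i j : Fin n} →
      IsDigraph R → IsDigraph R' → R i j ≡ true → R' j i ≡ true → AgreeOff i j R R' → Linked R R'
    reversal-by-order collapse {R = R} {R'} {i} {j} dR dR' rij r'ji R≈R' = by-case collapse
      where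
      i≢j : i ≢ j
      i≢j = edge-distinct dR rij
      low-linear : IsStrictLinearOrder (pairOrder i j)
      low-linear = pairOrder-linear i≢j
      high-linear : IsStrictLinearOrder (pairOrder j i)
      high-linear = pairOrder-linear (i≢j ∘ sym)
      i<j : pairOrder i j i j ≡ true
      i<j = pairOrder-below i≢j
      j<i : pairOrder j i i j ≡ false
      j<i = linear-asym high-linear j i (pairOrder-below (i≢j ∘ sym))
      R-low : imageType R (pairOrder i j) i j ≡ F fwd
      R-low = trans (imageType-below R (pairOrder i j) i<j) (cong F (proj₁ (pairType-edge dR rij)))
      R-high : imageType R (pairOrder j i) i j ≡ reverse (F bwd)
      R-high = trans (imageType-above R (pairOrder j i) j<i)
        (cong (reverse ∘ F) (proj₂ (pairType-edge dR rij)))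
      R'-low : imageType R' (pairOrder i j) i j ≡ F bwd
      R'-low = trans (imageType-below R' (pairOrder i j) i<j) (cong F (proj₂ (pairType-edge dR' r'ji)))
      R'-high : imageType R' (pairOrder j i) i j ≡ reverse (F fwd)
      R'-high = trans (imageType-above R' (pairOrder j i) j<i)
        (cong (reverse ∘ F) (proj₁ (pairType-edge dR' r'ji)))
      by-case : F fwd ≡ F bwd ⊎ F fwd ≡ non ⊎ F bwd ≡ non → Linked R R'
      by-case (inj₁ fwd≡bwd) =
        pairLinked i≢j dR dR' low-linear low-linear R≈R' (λ _ _ _ → refl)
          (trans R-low (trans fwd≡bwd (sym R'-low)))
      by-case (inj₂ (inj₁ fwd≡non)) =
        pairLinked i≢j dR dR' low-linear high-linear R≈R' (pairOrder-agree i≢j)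
          (trans R-low (trans fwd≡non (trans (cong reverse (sym fwd≡non)) (sym R'-high))))
      by-case (inj₂ (inj₂ bwd≡non)) =
        pairLinked i≢j dR dR' high-linear low-linear R≈R' (λ k l off → sym (pairOrder-agree i≢j k l off))
          (trans R-high (trans (cong reverse bwd≡non) (trans (sym bwd≡non) (sym R'-low))))

    -- If F sends non to an edge type, reversing the edge i → j keeps
    -- realisations in one orbit: both R and R' are linked to the digraph R₀
    -- in which the edge is deleted.
    reversal-by-deletion : F non ≡ F fwd ⊎ F non ≡ F bwd → ∀ {n} {R R' : FinRel n} {i j : Fin n} →
      IsDigraph R → IsDigraph R' → R i j ≡ true → R' j i ≡ true → AgreeOff i j R R' → Linked R R'
    reversal-by-deletion non≡edge {n} {R} {R'} {i} {j} dR dR' rij r'ji R≈R' =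
      linked-trans dR₀ (R~R₀ non≡edge) (linked-sym (R'~R₀ non≡edge))
      where
      i≢j : i ≢ j
      i≢j = edge-distinct dR rij
      R₀ : FinRel n
      R₀ = override i j R (λ _ _ → false)
      dR₀ : IsDigraph R₀
      dR₀ = override-digraph i j dR empty-digraph
      R≈R₀ : AgreeOff i j R R₀
      R≈R₀ k l off = sym (override-off off)
      R'≈R₀ : AgreeOff i j R' R₀
      R'≈R₀ k l off = trans (sym (R≈R' k l off)) (R≈R₀ k l off)
      r₀ij : R₀ i j ≡ false
      r₀ij = override-on {i = i} {j} {A = R} (inj₁ (refl , refl))
      r₀ji : R₀ j i ≡ false
      r₀ji = override-on {i = i} {j} {A = R} (inj₂ (refl , refl))
      R~R₀ : F non ≡ F fwd ⊎ F non ≡ F bwd → Linked R R₀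
      R~R₀ (inj₁ e) = clearLinked i≢j dR dR₀ R≈R₀ r₀ij r₀ji
        (trans (cong F (proj₁ (pairType-edge dR rij))) (sym e))
      R~R₀ (inj₂ e) = clearLinked (i≢j ∘ sym) dR dR₀ (AgreeOff-swap R≈R₀) r₀ji r₀ij
        (trans (cong F (proj₂ (pairType-edge dR rij))) (sym e))
      R'~R₀ : F non ≡ F fwd ⊎ F non ≡ F bwd → Linked R' R₀
      R'~R₀ (inj₁ e) = clearLinked (i≢j ∘ sym) dR' dR₀ (AgreeOff-swap R'≈R₀) r₀ji r₀ij
        (trans (cong F (proj₁ (pairType-edge dR' r'ji))) (sym e))
      R'~R₀ (inj₂ e) = clearLinked i≢j dR' dR₀ R'≈R₀ r₀ij r₀ji
        (trans (cong F (proj₂ (pairType-edge dR' r'ji))) (sym e))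

    reversalLinked : Degenerate F → ∀ {n} {R R' : FinRel n} {i j : Fin n} → IsDigraph R → IsDigraph R' →
      R i j ≡ true → R' j i ≡ true → AgreeOff i j R R' → Linked R R'
    reversalLinked (inj₁ e)               = reversal-by-order (inj₁ e)
    reversalLinked (inj₂ (inj₁ e))        = reversal-by-order (inj₂ (inj₁ e))
    reversalLinked (inj₂ (inj₂ (inj₁ e))) = reversal-by-order (inj₂ (inj₂ e))
    reversalLinked (inj₂ (inj₂ (inj₂ e))) = reversal-by-deletion e

    -- One step: copying B onto the pair {i,j} either changes nothing or
    -- reverses an edge.
    stepLinked : Degenerate F → ∀ {n} {R B : FinRel n} (i j : Fin n) → IsDigraph R → IsDigraph B →
      (R i j ∨ R j i) ≡ (B i j ∨ B j i) → Linked R (override i j R B)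
    stepLinked deg {n} {R} {B} i j dR dB same-graph =
      by-case (sameUnderlying (proj₂ dR i j) (proj₂ dB i j) same-graph)
      where
      R' : FinRel n
      R' = override i j R B
      dR' : IsDigraph R'
      dR' = override-digraph i j dR dB
      R≈R' : AgreeOff i j R R'
      R≈R' k l off = sym (override-off off)
      R'ij : R' i j ≡ B i j
      R'ij = override-on {i = i} {j} {A = R} (inj₁ (refl , refl))
      R'ji : R' j i ≡ B j i
      R'ji = override-on {i = i} {j} {A = R} (inj₂ (refl , refl))
      unchanged : R i j ≡ B i j → R j i ≡ B j i → ∀ k l → R k l ≡ R' k l
      unchanged rij≡bij rji≡bji k l with onPair? i j k l
      ... | yes (inj₁ (refl , refl)) = rij≡bij
      ... | yes (inj₂ (refl , refl)) = rji≡bji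
      ... | no _ = refl
      by-case : (R i j ≡ B i j × R j i ≡ B j i) ⊎ (R i j ≡ true × B j i ≡ true) ⊎
                (R j i ≡ true × B i j ≡ true) →
        Linked R R'
      by-case (inj₁ (rij≡bij , rji≡bji)) = linked-pointwise (unchanged rij≡bij rji≡bji)
      by-case (inj₂ (inj₁ (rij , bji))) =
        reversalLinked deg dR dR' rij (trans R'ji bji) R≈R'
      by-case (inj₂ (inj₂ (rji , bij))) =
        reversalLinked deg dR dR' rji (trans R'ij bij) (AgreeOff-swap R≈R')

    linked-by-pairs : Degenerate F → ∀ {n} {R B : FinRel n} → IsDigraph R → IsDigraph B → SameGraph R B →
      (ps : List (Fin n × Fin n)) → (∀ k l → R k l ≢ B k l → (k , l) ∈ ps) → Linked R B
    linked-by-pairs deg {R = R} {B} dR dB same [] covers = linked-pointwise equal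
      where
      equal : ∀ k l → R k l ≡ B k l
      equal k l with R k l Bool.≟ B k l
      ... | yes e = e
      ... | no ne with covers k l ne
      ...   | ()
    linked-by-pairs deg {n} {R} {B} dR dB same ((i , j) ∷ ps) covers =
      linked-trans dR' (stepLinked deg i j dR dB (same i j)) (linked-by-pairs deg dR' dB same' ps covers')
      where
      R' : FinRel n
      R' = override i j R B
      dR' : IsDigraph R'
      dR' = override-digraph i j dR dB
      same' : SameGraph R' B
      same' k l = by-pair (onPair? i j k l)
        where
        by-pair : Dec (OnPair i j k l) → (R' k l ∨ R' l k) ≡ (B k l ∨ B l k)
        by-pair (yes p) = cong₂ _∨_ (override-on p) (override-on (OnPair-flip p))
        by-pair (no off) = trans (cong₂ _∨_ (override-off off) (override-off (off ∘ OnPair-flip))) (same k l)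
      covers' : ∀ k l → R' k l ≢ B k l → (k , l) ∈ ps
      covers' k l R'≢B = by-pair (onPair? i j k l)
        where
        by-pair : Dec (OnPair i j k l) → (k , l) ∈ ps
        by-pair (yes p) = ⊥-elim (R'≢B (override-on p))
        by-pair (no off) with covers k l (R'≢B ∘ trans (override-off off))
        ... | here kl≡ij = ⊥-elim (off (inj₁ (cong proj₁ kl≡ij , cong proj₂ kl≡ij)))
        ... | there kl∈ps = kl∈ps

    -- In the degenerate case G contains Aut(Γ): a map g preserving the
    -- underlying graph agrees on each initial segment {0,…,m-1} with an
    -- element of G, and G is closed.
    degenerate⇒Aut-Γ⊆G : Degenerate F → ∀ g → IsAut (Sym E) g → G g
    degenerate⇒Aut-Γ⊆G deg g (g-perm , g-preserves) =
      proj₂ (proj₂ (proj₂ (proj₂ G-closed))) g g-perm approximate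
      where
      approximate : InClosure G g
      approximate n a =
        restrict (linked toℕ (g ∘ toℕ) (induced-realises toℕ-distinct) (induced-realises g-distinct))
        where
        m : ℕ
        m = ℕ.suc (tupleMax n a)
        linked : Linked (induced toℕ) (induced (g ∘ toℕ))
        linked = linked-by-pairs deg (induced-digraph toℕ) (induced-digraph (g ∘ toℕ))
          (λ k l → sym (g-preserves (toℕ k) (toℕ l))) (cartesianProduct (allFin m) (allFin m))
          (λ k l _ → ∈-cartesianProduct⁺ (∈-allFin k) (∈-allFin l))
        toℕ-distinct : ∀ (k l : Fin m) → toℕ k ≡ toℕ l → k ≡ l
        toℕ-distinct _ _ = toℕ-injective
        g-distinct : ∀ (k l : Fin m) → g (toℕ k) ≡ g (toℕ l) → k ≡ l
        g-distinct _ _ e = toℕ-injective (permutation-injective g-perm _ _ e)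
        restrict : toℕ ∼ g ∘ toℕ → Σ (ℕ → ℕ) λ h → G h × (∀ i → h (a i) ≡ g (a i))
        restrict (h , h∈G , h≡g) = h , h∈G , λ i → agree-below h g h≡g (a i) (s≤s (tupleMax-bound n a i))

    uniform-behaviour : (∀ t → F (reverse t) ≡ reverse (F t)) → ∀ {x y} → x ≢ y →
      pairType E (f x) (f y) ≡ F (pairType E x y)
    uniform-behaviour commutes {x} {y} x≢y = trans (image-lemma x≢y) (oriented (L x y))
      where
      open ≡-Reasoning
      oriented : ∀ o → orient o (pairType E x y) (pairType E y x) ≡ F (pairType E x y)
      oriented true  = refl
      oriented false = begin
        reverse (F (pairType E y x))            ≡⟨ cong (reverse ∘ F) (pairType-swap E-digraph x y) ⟩
        reverse (F (reverse (pairType E x y)))  ≡⟨ cong reverse (commutes (pairType E x y)) ⟩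
        reverse (reverse (F (pairType E x y)))  ≡⟨ reverse-involutive _ ⟩
        F (pairType E x y)                      ∎

    behavesLikeId : (∀ t → F t ≡ t) → BehavesLikeId E f
    behavesLikeId F≗id n a i j = mk⇔ f-injective (cong f) , edge (a i) (a j)
      where
      commutes : ∀ t → F (reverse t) ≡ reverse (F t)
      commutes t = trans (F≗id (reverse t)) (cong reverse (sym (F≗id t)))
      edge : ∀ x y → E (f x) (f y) ≡ E x y
      edge x y with x ℕ.≟ y
      ... | yes refl = trans (E-irreflexive _) (sym (E-irreflexive _))
      ... | no x≢y = edge-from-pairType {R = E} {S = E} (trans (uniform-behaviour commutes x≢y) (F≗id _))

    behavesLikeMinus : (∀ t → F t ≡ reverse t) → BehavesLikeMinus E f
    behavesLikeMinus F≗rev = (λ _ _ → f-injective) , edge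
      where
      commutes : ∀ t → F (reverse t) ≡ reverse (F t)
      commutes t = trans (F≗rev (reverse t)) (cong reverse (sym (F≗rev t)))
      edge : ∀ x y → E (f x) (f y) ≡ E y x
      edge x y with x ℕ.≟ y
      ... | yes refl = trans (E-irreflexive _) (sym (E-irreflexive _))
      ... | no x≢y = edge-from-pairType {R = E} {S = E}
        (trans (uniform-behaviour commutes x≢y) (trans (F≗rev _) (sym (pairType-swap E-digraph x y))))

mainTheorem17 : (E L : BRel) → IsGenericDigraph E → IsGenericOrderedDigraph E L →
    (G : (ℕ → ℕ) → Set) → IsClosedSubgroup G → (∀ g → IsAut E g → G g) →
    (f : ℕ → ℕ) → InTmcl E G f → IsCanonical E L f →
    BehavesLikeId E f ⊎ BehavesLikeMinus E f ⊎ (∀ g → IsAut (Sym E) g → G g)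
mainTheorem17 E L E-generic EL-generic G G-closed Aut⊆G f f-tmcl f-canonical = conclude (trichotomy F)
  where
  open Generic E L E-generic EL-generic G G-closed Aut⊆G
  open Canonical f f-tmcl f-canonical
  conclude : (∀ t → F t ≡ t) ⊎ (∀ t → F t ≡ reverse t) ⊎ Degenerate F →
    BehavesLikeId E f ⊎ BehavesLikeMinus E f ⊎ (∀ g → IsAut (Sym E) g → G g)
  conclude (inj₁ F≗id)         = inj₁ (behavesLikeId F≗id)
  conclude (inj₂ (inj₁ F≗rev)) = inj₂ (inj₁ (behavesLikeMinus F≗rev))
  conclude (inj₂ (inj₂ deg))   = inj₂ (inj₂ (degenerate⇒Aut-Γ⊆G deg))
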